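{- Let $H=([n],E)$ be a hypergraph and let $F,F'\in E$ be two edges. Then $Q_F\cap Q_{F'}=\emptyset$ if and only if $F\cup F'=[n]$ and $F\cap F'\neq\emptyset$.
   Context: A hypergraph $H=([n],E)$ has vertex set $[n]$ and a set $E$ of subsets of $[n]$ (edges), with no edges of size at most $1$, no isolated vertices, and no edge properly contained in another. The coloring complex $\Delta_H$ is the simplicial complex on the nonempty proper subsets of $[n]$ whose faces are chains $\emptyset\ne A_1\subsetneq\cdots\subsetneq A_l\ne[n]$ ($l\ge0$) such that, with $A_0=\emptyset$, $A_{l+1}=[n]$, some $A_i\setminus A_{i-1}$ contains an edge of $H$. For an edge $F$, the edge sphere $Q_F$ is the subcomplex of $\Delta_H$ consisting of the faces for which $F\subseteq A_i\setminus A_{i-1}$ for some $1\le i\le l+1$. Here $Q_F\cap Q_{F'}=\emptyset$ means the intersection has no nonempty face (is empty as a topological space). -}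

module Defs where

open import Data.Nat using (ℕ; _≤_)
open import Data.Product using (_×_; ∃)
open import Data.List using (List; []; _∷_)
open import Data.List.Membership.Propositional using () renaming (_∈_ to _∈ₗ_)
open import Data.List.Relation.Unary.All using (All)
open import Data.List.Relation.Unary.Any using (Any)
open import Data.List.Relation.Unary.Linked using (Linked)
open import Data.List.Relation.Unary.Unique.Propositional using (Unique)
open import Data.Fin using (Fin)
open import Data.Fin.Subset using (Subset; _∈_; _⊆_; _⊂_; _─_; ⊥; ⊤; ∁; Nonempty; ∣_∣)
open import Relation.Nullary using (¬_)
open import Data.Empty renaming (⊥ to ⊥₀)
open import Data.Unit renaming (⊤ to ⊤₀)

record Hypergraph (n : ℕ) : Set where
  field
    edges       : List (Subset n)
    edges-uniq  : Unique edges
    edge-size   : All (λ e → 2 ≤ ∣ e ∣) edges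
    no-isolated : ∀ (v : Fin n) → Any (λ e → v ∈ e) edges
    antichain   : ∀ {e e′} → e ∈ₗ edges → e′ ∈ₗ edges → ¬ (e ⊂ e′)
open Hypergraph public

IsChain : ∀ {n} → List (Subset n) → Set
IsChain {n} As =
  Linked _⊂_ As × All (λ A → Nonempty A × Nonempty (∁ A)) As

-- The consecutive differences A_i ∖ A_{i-1}, i = 1, …, l+1,
-- with A₀ = ∅ and A_{l+1} = [n].  (blocks prev As, prev = A_{i-1}.)
blocks : ∀ {n} → Subset n → List (Subset n) → List (Subset n)
blocks prev []       = (⊤ ─ prev) ∷ []
blocks prev (A ∷ As) = (A ─ prev) ∷ blocks A As

chainBlocks : ∀ {n} → List (Subset n) → List (Subset n)
chainBlocks = blocks ⊥

IsFaceΔ : ∀ {n} → Hypergraph n → List (Subset n) → Set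
IsFaceΔ H As =
  IsChain As × Any (λ D → Any (λ e → e ⊆ D) (edges H)) (chainBlocks As)

IsFaceQ : ∀ {n} → Hypergraph n → Subset n → List (Subset n) → Set
IsFaceQ H F As = IsFaceΔ H As × Any (λ D → F ⊆ D) (chainBlocks As)

NonemptyFace : ∀ {n} → List (Subset n) → Set
NonemptyFace []      = ⊥₀
NonemptyFace (_ ∷ _) = ⊤₀

-- Q_F ∩ Q_{F'} = ∅ as a topological space: no nonempty face lies in both.
QDisjoint : ∀ {n} → Hypergraph n → Subset n → Subset n → Set
QDisjoint H F F′ =
  ∀ As → NonemptyFace As → IsFaceQ H F As → IsFaceQ H F′ As → ⊥₀

module Submission where

-- The blocks A₁ ∖ A₀, …, A_{l+1} ∖ A_l of a weakly increasing chain are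
-- pairwise disjoint: a point of a later block avoids every earlier A_i.
--
-- (⇐) Let A₁ ⊊ ⋯ ⊊ A_l (l ≥ 1) be a face of Q_F and of Q_F′.  Since F and F′
--     share a point, disjointness of the blocks forces them into the same
--     block D, so [n] = F ∪ F′ ⊆ D.  But no block of a nonempty chain is all
--     of [n]: the first block misses ∁ A₁ ≠ ∅ and the others miss A₁ ≠ ∅.
-- (⇒) Both conditions are decidable, so we refute their failure by a
--     one-element chain lying in Q_F ∩ Q_F′:  if F ∩ F′ = ∅ take the chain
--     (F), whose blocks are F and ∁ F ⊇ F′;  if F ∪ F′ ≠ [n] take the chain
--     (F ∪ F′), whose first block contains both edges.

open import Defs
open import Data.Nat using (ℕ)
open import Data.Product using (_×_)
open import Data.List.Membership.Propositional using (_∈_)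
open import Data.Fin.Subset using (Subset; _∪_; _∩_; ⊤; Nonempty)
open import Function.Bundles using (_⇔_)
open import Relation.Binary.PropositionalEquality using (_≡_)

open import Data.Nat using (_≤_)
open import Data.Product using (_,_; proj₁; proj₂)
open import Data.Sum using (_⊎_; inj₁; inj₂; [_,_]′)
open import Data.Bool using (true)
open import Data.Vec using (_∷_; here; there)
open import Data.List using (List) renaming (_∷_ to _∷ₗ_; [] to []ₗ)
import Data.List.Relation.Unary.Any as Any
open import Data.List.Relation.Unary.Any using (Any; here; there)
open import Data.List.Relation.Unary.All using () renaming (_∷_ to _∷ᴬ_; [] to []ᴬ)
import Data.List.Relation.Unary.All as All
import Data.List.Relation.Unary.Linked as Linked
open import Data.List.Relation.Unary.Linked using (Linked; [-])
open import Data.Fin using (Fin)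
open import Data.Fin.Subset using (∣_∣; _─_; ∁; _⊆_; _∉_; Empty)
  renaming (_∈_ to _∈ˢ_)
open import Data.Fin.Subset.Properties
open import Data.Empty renaming (⊥ to ⊥₀)
open import Relation.Nullary.Decidable using (decidable-stable)
open import Relation.Binary.PropositionalEquality using (refl; subst; sym)
open import Function.Bundles using (mk⇔)

x∈p─q⇒x∉q : ∀ {n} (p q : Subset n) {x : Fin n} → x ∈ˢ p ─ q → x ∉ q
x∈p─q⇒x∉q (_ ∷ p) (true  ∷ q) ()        here
x∈p─q⇒x∉q (_ ∷ p) (_     ∷ q) (there m) (there k) = x∈p─q⇒x∉q p q m k

∁-Empty⇒≡⊤ : ∀ {n} {p : Subset n} → Empty (∁ p) → p ≡ ⊤
∁-Empty⇒≡⊤ empty = ⊆-antisym ⊆⊤ (λ {x} _ → x∉∁p⇒x∈p (λ x∈∁p → empty (x , x∈∁p)))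

edge-nonempty : ∀ {n} (H : Hypergraph n) {F : Subset n} → F ∈ edges H → Nonempty F
edge-nonempty {n} H {F} F∈H = decidable-stable (nonempty? F) size-contradiction
  where
  size-contradiction : Empty F → ⊥₀
  size-contradiction empty
    with subst (2 ≤_) (∣⊥∣≡0 n) (subst (λ p → 2 ≤ ∣ p ∣) (Empty-unique empty)
                                        (All.lookup (edge-size H) F∈H))
  ... | ()

block-avoids-start : ∀ {n} {prev : Subset n} {As : List (Subset n)} {x : Fin n} →
  Linked _⊆_ (prev ∷ₗ As) → Any (x ∈ˢ_) (blocks prev As) → x ∉ prev
block-avoids-start {prev = prev} {As = []ₗ}     _          (here x∈D) = x∈p─q⇒x∉q ⊤ prev x∈D
block-avoids-start {prev = prev} {As = A ∷ₗ As} _          (here x∈D) = x∈p─q⇒x∉q A prev x∈D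
block-avoids-start {prev = prev} {As = A ∷ₗ As} (prev⊆A Linked.∷ chain) (there x∈D) =
  λ x∈prev → block-avoids-start chain x∈D (prev⊆A x∈prev)

-- Blocks are disjoint, so two sets sharing a point x, each contained in a
-- block, are contained in the same block.
shared-block : ∀ {n} {prev : Subset n} {As : List (Subset n)} {F F′ : Subset n} {x : Fin n} →
  Linked _⊆_ As → x ∈ˢ F → x ∈ˢ F′ →
  Any (F ⊆_) (blocks prev As) → Any (F′ ⊆_) (blocks prev As) →
  Any (λ D → F ⊆ D × F′ ⊆ D) (blocks prev As)
shared-block {As = []ₗ}     _     _   _    (here F⊆D) (here F′⊆D) = here (F⊆D , F′⊆D)
shared-block {As = A ∷ₗ As} _     _   _    (here F⊆D) (here F′⊆D) = here (F⊆D , F′⊆D)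
shared-block {prev = prev} {As = A ∷ₗ As} chain x∈F x∈F′ (here F⊆D) (there F′⊆D′) =
  ⊥-elim (block-avoids-start chain (Any.map (λ s → s x∈F′) F′⊆D′) (p─q⊆p A prev (F⊆D x∈F)))
shared-block {prev = prev} {As = A ∷ₗ As} chain x∈F x∈F′ (there F⊆D′) (here F′⊆D) =
  ⊥-elim (block-avoids-start chain (Any.map (λ s → s x∈F) F⊆D′) (p─q⊆p A prev (F′⊆D x∈F′)))
shared-block {As = A ∷ₗ As} chain x∈F x∈F′ (there F⊆D) (there F′⊆D) =
  there (shared-block (Linked.tail chain) x∈F x∈F′ F⊆D F′⊆D)

-- If the chain starts with a nonempty proper subset A₁, no block is all of
-- [n]: the first block misses ∁ A₁, the later ones miss A₁.
no-full-block : ∀ {n} {prev A : Subset n} {As : List (Subset n)} →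
  Linked _⊆_ (A ∷ₗ As) → Nonempty A → Nonempty (∁ A) →
  Any (⊤ ⊆_) (blocks prev (A ∷ₗ As)) → ⊥₀
no-full-block {prev = prev} {A} _ _ (z , z∈∁A) (here ⊤⊆D) =
  x∈∁p⇒x∉p z∈∁A (p─q⊆p A prev (⊤⊆D ∈⊤))
no-full-block chain (y , y∈A) _ (there ⊤⊆D) =
  block-avoids-start chain (Any.map (λ s → s ∈⊤) ⊤⊆D) y∈A

singleton-face : ∀ {n} (H : Hypergraph n) {F A : Subset n} → F ∈ edges H →
  Nonempty A → Nonempty (∁ A) → F ⊆ A ⊎ F ⊆ ∁ A → IsFaceQ H F (A ∷ₗ []ₗ)
singleton-face H {F} {A} F∈H neA ne∁A side = (chain , edge-in-block) , F-in-block
  where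
  chain : IsChain (A ∷ₗ []ₗ)
  chain = [-] , (neA , ne∁A) ∷ᴬ []ᴬ

  F-in-block : Any (F ⊆_) (chainBlocks (A ∷ₗ []ₗ))
  F-in-block = [ (λ F⊆A → here (λ {_} x∈F → x∈p∧x∉q⇒x∈p─q (F⊆A x∈F) ∉⊥))
               , (λ F⊆∁A → there (here (λ {_} x∈F → x∈p∧x∉q⇒x∈p─q ∈⊤ (x∈∁p⇒x∉p (F⊆∁A x∈F)))))
               ]′ side

  edge-in-block : Any (λ D → Any (_⊆ D) (edges H)) (chainBlocks (A ∷ₗ []ₗ))
  edge-in-block = Any.map (λ F⊆D → Any.map (λ { refl → F⊆D }) F∈H) F-in-block

module _ {n : ℕ} (H : Hypergraph n) {F F′ : Subset n}
         (F∈H : F ∈ edges H) (F′∈H : F′ ∈ edges H) where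

  disjoint⇒meet : QDisjoint H F F′ → Nonempty (F ∩ F′)
  disjoint⇒meet disj = decidable-stable (nonempty? (F ∩ F′)) common-face
    where
    common-face : Empty (F ∩ F′) → ⊥₀
    common-face empty = disj (F ∷ₗ []ₗ) _ (face F∈H (inj₁ ⊆-refl))
                                          (face F′∈H (inj₂ F′⊆∁F))
      where
      F′⊆∁F : F′ ⊆ ∁ F
      F′⊆∁F x∈F′ = x∉p⇒x∈∁p (λ x∈F → empty (_ , x∈p∩q⁺ (x∈F , x∈F′)))
      face : ∀ {G} → G ∈ edges H → G ⊆ F ⊎ G ⊆ ∁ F → IsFaceQ H G (F ∷ₗ []ₗ)
      face G∈H = singleton-face H G∈H (edge-nonempty H F∈H)
                   (_ , F′⊆∁F (proj₂ (edge-nonempty H F′∈H)))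

  disjoint⇒cover : QDisjoint H F F′ → F ∪ F′ ≡ ⊤
  disjoint⇒cover disj = ∁-Empty⇒≡⊤ common-face
    where
    common-face : Nonempty (∁ (F ∪ F′)) → ⊥₀
    common-face ne∁ = disj (F ∪ F′ ∷ₗ []ₗ) _ (face F∈H (p⊆p∪q F′)) (face F′∈H (q⊆p∪q F F′))
      where
      neF∪F′ : Nonempty (F ∪ F′)
      neF∪F′ = _ , p⊆p∪q F′ (proj₂ (edge-nonempty H F∈H))
      face : ∀ {G} → G ∈ edges H → G ⊆ F ∪ F′ → IsFaceQ H G (F ∪ F′ ∷ₗ []ₗ)
      face G∈H G⊆F∪F′ = singleton-face H G∈H neF∪F′ ne∁ (inj₁ G⊆F∪F′)

  -- A common nonempty face would put F and F′ in one block, which then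
  -- contains F ∪ F′ = [n].
  cover-meet⇒disjoint : (F ∪ F′ ≡ ⊤) × Nonempty (F ∩ F′) → QDisjoint H F F′
  cover-meet⇒disjoint (cover , (x , x∈F∩F′)) (A ∷ₗ As) _
                      (((strict , (neA , ne∁A) ∷ᴬ _) , _) , F-in) (_ , F′-in) =
    no-full-block chain neA ne∁A (Any.map ⊤⊆block common)
    where
    chain : Linked _⊆_ (A ∷ₗ As)
    chain = Linked.map proj₁ strict
    common : Any (λ D → F ⊆ D × F′ ⊆ D) (chainBlocks (A ∷ₗ As))
    common = shared-block chain (proj₁ (x∈p∩q⁻ F F′ x∈F∩F′))
                                (proj₂ (x∈p∩q⁻ F F′ x∈F∩F′)) F-in F′-in
    ⊤⊆block : ∀ {D} → F ⊆ D × F′ ⊆ D → ⊤ ⊆ D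
    ⊤⊆block (F⊆D , F′⊆D) {y} _ =
      [ F⊆D , F′⊆D ]′ (x∈p∪q⁻ F F′ (subst (y ∈ˢ_) (sym cover) ∈⊤))

lemma5p4 : ∀ {n : ℕ} (H : Hypergraph n) (F F′ : Subset n) →
    F ∈ edges H → F′ ∈ edges H →
    (QDisjoint H F F′ ⇔ ((F ∪ F′ ≡ ⊤) × Nonempty (F ∩ F′)))
lemma5p4 H F F′ F∈H F′∈H =
  mk⇔ (λ disj → disjoint⇒cover H F∈H F′∈H disj , disjoint⇒meet H F∈H F′∈H disj)
      (cover-meet⇒disjoint H F∈H F′∈H)
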